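{- Let $G$ be a (finite, simple, connected) graph of order $n\ge 7$ having at least one vertex $u$ with $3\le\deg(u)\le n-4$. Then $\beta_p(G)\le n-3$.
   Context: For $u$ a vertex and $S$ a vertex set, $d(u,S)=\min_{w\in S}d(u,w)$. A partition $\Pi=\{S_1,\dots,S_k\}$ of $V(G)$ is locating if the vectors $r(u|\Pi)=(d(u,S_1),\dots,d(u,S_k))$ are pairwise distinct over $u\in V(G)$; $\beta_p(G)$ is the minimum size of a locating partition. -}

module Defs where

open import Data.Nat using (ℕ; zero; suc; _≤_)
open import Data.Fin using (Fin)
open import Data.Bool using (Bool; true; false; T)
open import Data.List using (length; filter; allFin)
open import Data.Product using (Σ; ∃; _×_; _,_)
open import Relation.Nullary using (¬_)
open import Relation.Binary.PropositionalEquality using (_≡_)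
open import Function.Bundles using (_⇔_)

record Graph (n : ℕ) : Set where
  field
    adj   : Fin n → Fin n → Bool
    sym   : ∀ u v → adj u v ≡ adj v u
    irrefl : ∀ u → adj u u ≡ false
open Graph public

data Walk {n : ℕ} (G : Graph n) : Fin n → Fin n → ℕ → Set where
  here : ∀ u → Walk G u u zero
  step : ∀ {u w v k} → T (adj G u w) → Walk G w v k → Walk G u v (suc k)

Connected : ∀ {n} → Graph n → Set
Connected {n} G = ∀ (u v : Fin n) → ∃ λ k → Walk G u v k

Dist : ∀ {n} → Graph n → Fin n → Fin n → ℕ → Set
Dist G u v k = Walk G u v k × (∀ m → Walk G u v m → k ≤ m)

degree : ∀ {n} → Graph n → Fin n → ℕ
degree {n} G u = length (filter (λ v → T? (adj G u v)) (allFin n))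
  where
    open import Relation.Nullary.Decidable using (Dec)
    open import Data.Bool.Properties using (T?)

-- A partition of V(G) into k classes S_0,…,S_{k-1}: a class assignment
-- cls : V → Fin k with every class nonempty.
record Partition (n k : ℕ) : Set where
  field
    cls      : Fin n → Fin k
    nonempty : ∀ (i : Fin k) → ∃ λ w → cls w ≡ i
open Partition public

DistToClass : ∀ {n k} → Graph n → Partition n k → Fin n → Fin k → ℕ → Set
DistToClass {n} G P u i m =
  (∃ λ w → cls P w ≡ i × Dist G u w m)
  × (∀ w → cls P w ≡ i → ∀ m' → Dist G u w m' → m ≤ m')

SameRep : ∀ {n k} → Graph n → Partition n k → Fin n → Fin n → Set
SameRep G P u v = ∀ i m → DistToClass G P u i m ⇔ DistToClass G P v i m

Locating : ∀ {n k} → Graph n → Partition n k → Set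
Locating {n} G P = ∀ (u v : Fin n) → SameRep G P u v → u ≡ v

PartitionDimLe : ∀ {n} → Graph n → ℕ → Set
PartitionDimLe {n} G b = ∃ λ k → k ≤ b × Σ (Partition n k) (λ P → Locating G P)

module Submission where

-- Let c be a vertex with 3 ≤ deg c ≤ n - 4.  Then c has
-- three distinct neighbours x₀, x₁, x₂ and three distinct non-neighbours
-- y₀, y₁, y₂ other than c.  Merge each pair {xᵢ, yᵢ} into one class and keep
-- every other vertex as a singleton: this is a partition into n - 3 classes.
-- It is locating: vertices in different classes are told apart by the class
-- at distance 0, and xᵢ, yᵢ are told apart by the singleton class {c}, which
-- is at distance 1 from xᵢ but not from yᵢ.

open import Defs
open import Data.Nat using (ℕ; zero; suc; _≤_; _∸_; _+_; z≤n; s≤s)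
open import Data.Nat.Properties
  using (≤-trans; ≤-refl; ≤-reflexive; +-comm; +-suc; +-cancelˡ-≤; module ≤-Reasoning)
open import Data.Fin using (Fin; zero; suc; punchOut; punchIn; inject≤; _≟_)
open import Data.Fin.Properties
  using (punchOut-injective; punchOut-cong; punchOut-punchIn; punchIn-injective;
         punchInᵢ≢i; inject≤-injective; suc-injective; 0≢1+n; any?)
open import Data.Product using (∃; _×_; _,_; proj₁)
open import Data.Sum as Sum using (_⊎_; inj₁; inj₂)
open import Data.Bool using (T)
open import Data.Bool.Properties using (T?)
open import Data.Empty using (⊥-elim)
open import Relation.Nullary using (¬_; yes; no)
open import Relation.Nullary.Decidable using (¬?)
open import Relation.Unary using (Decidable)
open import Relation.Binary.PropositionalEquality
  using (_≡_; _≢_; refl; cong; trans; subst; module ≡-Reasoning) renaming (sym to sym≡)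
open import Function using (_∘_)
open import Function.Bundles using (Equivalence)
open import Data.List using (List; []; _∷_; length; filter; allFin; lookup)
open import Data.List.Properties using (length-tabulate)
open import Data.List.Relation.Unary.All as All using (All)
open import Data.List.Relation.Unary.AllPairs using (_∷_)
open import Data.List.Relation.Unary.Unique.Propositional using (Unique)
open import Data.List.Membership.Propositional.Properties using (∈-lookup)
import Data.List.Relation.Unary.Unique.Propositional.Properties as Unique
import Data.List.Relation.Unary.All.Properties as All

no-loop : ∀ {n} (G : Graph n) (u : Fin n) → ¬ T (adj G u u)
no-loop G u = subst T (irrefl G u)

-- A walk of length 0 stays put; a walk of length 1 is an edge.  These are
-- the only distances the locating argument inspects.
walk-length-0 : ∀ {n} {G : Graph n} {a b} → Walk G a b 0 → a ≡ b
walk-length-0 (here _) = refl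

walk-length-1 : ∀ {n} {G : Graph n} {a b} → Walk G a b 1 → T (adj G a b)
walk-length-1 (step e (here _)) = e

Separated : ∀ {n} → Graph n → Fin n → Fin n → Fin n → Set
Separated G c a b = T (adj G c a) × ¬ T (adj G c b) × b ≢ c

module LocatingCriterion {n k} (G : Graph n) (P : Partition n k) (c : Fin n)
  (separated : ∀ {a b} → cls P a ≡ cls P b →
                 a ≡ b ⊎ Separated G c a b ⊎ Separated G c b a) where

  at-zero : ∀ a → DistToClass G P a (cls P a) 0
  at-zero a = (a , refl , here a , λ _ _ → z≤n) , λ _ _ _ _ → z≤n

  -- Equal representations force equal classes (look at the 0 coordinate).
  same-class : ∀ a b → SameRep G P a b → cls P a ≡ cls P b
  same-class a b same with Equivalence.to (same (cls P a) 0) (at-zero a)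
  ... | (w , w∈a , walk , _) , _ with walk-length-0 walk
  ... | refl = sym≡ w∈a

  -- c is alone in its class, since c separates nothing from itself.
  alone : ∀ w → cls P w ≡ cls P c → w ≡ c
  alone w eq with separated eq
  ... | inj₁ w≡c                  = w≡c
  ... | inj₂ (inj₁ (_ , _ , c≢c)) = ⊥-elim (c≢c refl)
  ... | inj₂ (inj₂ (cc , _))      = ⊥-elim (no-loop G c cc)

  at-one : ∀ a → T (adj G c a) → DistToClass G P a (cls P c) 1
  at-one a ca =
    (c , refl , step (subst T (sym G c a) ca) (here c) , positive) ,
    λ w w∈c k d → positive k (subst (λ z → Walk G a z k) (alone w w∈c) (proj₁ d))
    where
    positive : ∀ k → Walk G a c k → 1 ≤ k
    positive zero walk with walk-length-0 walk
    ... | refl = ⊥-elim (no-loop G a ca)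
    positive (suc k) _ = s≤s z≤n

  not-at-one : ∀ b → ¬ T (adj G c b) → ¬ DistToClass G P b (cls P c) 1
  not-at-one b ¬cb ((w , w∈c , walk , _) , _) with alone w w∈c
  ... | refl = ¬cb (subst T (sym G b c) (walk-length-1 walk))

  locating : Locating G P
  locating a b same with separated (same-class a b same)
  ... | inj₁ a≡b                   = a≡b
  ... | inj₂ (inj₁ (ca , ¬cb , _)) =
    ⊥-elim (not-at-one b ¬cb (Equivalence.to (same (cls P c) 1) (at-one a ca)))
  ... | inj₂ (inj₂ (cb , ¬ca , _)) =
    ⊥-elim (not-at-one a ¬ca (Equivalence.from (same (cls P c) 1) (at-one b cb)))

record Distinct (A : Set) (k : ℕ) (Q : A → Set) : Set where
  field
    pick           : Fin k → A
    pick-injective : ∀ {i j} → pick i ≡ pick j → i ≡ j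
    pick-property  : ∀ i → Q (pick i)
open Distinct

reindex : ∀ {A Q k l} (e : Fin k → Fin l) → (∀ {i j} → e i ≡ e j → i ≡ j) →
          Distinct A l Q → Distinct A k Q
reindex e e-inj D = record
  { pick           = pick D ∘ e
  ; pick-injective = e-inj ∘ pick-injective D
  ; pick-property  = pick-property D ∘ e
  }

lookup-injective : ∀ {A : Set} {xs : List A} → Unique xs →
                   ∀ {i j} → lookup xs i ≡ lookup xs j → i ≡ j
lookup-injective {xs = _ ∷ _} _                {zero}  {zero}  _  = refl
lookup-injective {xs = _ ∷ _} (x≢xs ∷ _)       {zero}  {suc j} eq =
  ⊥-elim (All.lookup x≢xs (∈-lookup j) eq)
lookup-injective {xs = _ ∷ _} (x≢xs ∷ _)       {suc i} {zero}  eq =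
  ⊥-elim (All.lookup x≢xs (∈-lookup i) (sym≡ eq))
lookup-injective {xs = _ ∷ _} (_ ∷ unique)     {suc i} {suc j} eq =
  cong suc (lookup-injective unique eq)

from-list : ∀ {A Q k} (xs : List A) → Unique xs → All Q xs → k ≤ length xs →
            Distinct A k Q
from-list xs unique all k≤ = reindex (λ i → inject≤ i k≤) (inject≤-injective k≤ k≤ _ _) record
  { pick           = lookup xs
  ; pick-injective = lookup-injective unique
  ; pick-property  = λ i → All.lookup all (∈-lookup i)
  }

avoid : ∀ {N Q k} (c : Fin N) → Distinct (Fin N) (suc k) Q →
        Distinct (Fin N) k (λ v → Q v × v ≢ c)
avoid c D with any? (λ i → pick D i ≟ c)
... | yes (i , picked) = record
  { pick           = pick D ∘ punchIn i
  ; pick-injective = punchIn-injective i _ _ ∘ pick-injective D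
  ; pick-property  = λ j → pick-property D (punchIn i j) ,
      λ eq → punchInᵢ≢i i j (pick-injective D (trans eq (sym≡ picked)))
  }
... | no unpicked = record
  { pick           = pick D ∘ suc
  ; pick-injective = λ eq → suc-injective (pick-injective D eq)
  ; pick-property  = λ j → pick-property D (suc j) , λ eq → unpicked (suc j , eq)
  }

length-split : ∀ {A : Set} {P : A → Set} (P? : Decidable P) (xs : List A) →
               length xs ≤ length (filter P? xs) + length (filter (¬? ∘ P?) xs)
length-split P? [] = z≤n
length-split P? (x ∷ xs) with P? x
... | yes _ = s≤s (length-split P? xs)
... | no _  = ≤-trans (s≤s (length-split P? xs))
                      (≤-reflexive (sym≡ (+-suc (length (filter P? xs)) _)))

at-least-four : ∀ N {d e} → 3 ≤ d → d ≤ N ∸ 4 → N ≤ d + e → 4 ≤ e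
at-least-four (suc (suc (suc (suc N)))) {d} {e} _ d≤N N≤d+e = +-cancelˡ-≤ d 4 e (begin
  d + 4 ≡⟨ +-comm d 4 ⟩
  4 + d ≤⟨ s≤s (s≤s (s≤s (s≤s d≤N))) ⟩
  4 + N ≤⟨ N≤d+e ⟩
  d + e ∎)
  where open ≤-Reasoning
at-least-four 0       (s≤s _) ()
at-least-four 1       (s≤s _) ()
at-least-four 2       (s≤s _) ()
at-least-four 3       (s≤s _) ()

module Neighbourhood {N} (G : Graph N) (c : Fin N) where

  adjacent? : Decidable (λ v → T (adj G c v))
  adjacent? v = T? (adj G c v)

  neighbours non-neighbours : List (Fin N)
  neighbours     = filter adjacent? (allFin N)
  non-neighbours = filter (¬? ∘ adjacent?) (allFin N)

  three-neighbours : 3 ≤ degree G c → Distinct (Fin N) 3 (λ v → T (adj G c v))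
  three-neighbours =
    from-list neighbours (Unique.filter⁺ adjacent? (Unique.allFin⁺ N))
              (All.all-filter adjacent? (allFin N))

  three-non-neighbours : 3 ≤ degree G c → degree G c ≤ N ∸ 4 →
                         Distinct (Fin N) 3 (λ v → ¬ T (adj G c v) × v ≢ c)
  three-non-neighbours 3≤deg deg≤ = avoid c (from-list non-neighbours
    (Unique.filter⁺ (¬? ∘ adjacent?) (Unique.allFin⁺ N))
    (All.all-filter (¬? ∘ adjacent?) (allFin N))
    (at-least-four N 3≤deg deg≤ N≤deg+non))
    where
    N≤deg+non : N ≤ degree G c + length non-neighbours
    N≤deg+non = subst (_≤ degree G c + length non-neighbours) (length-tabulate (λ v → v))
                      (length-split adjacent? (allFin N))

record Matching (N k : ℕ) : Set where
  field
    left right      : Fin k → Fin N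
    left-injective  : ∀ {i j} → left i ≡ left j → i ≡ j
    right-injective : ∀ {i j} → right i ≡ right j → i ≡ j
    left≢right      : ∀ i j → left i ≢ right j
open Matching

Matched : ∀ {N k} → Matching N k → Fin N → Fin N → Set
Matched M v w = ∃ λ i → left M i ≡ v × right M i ≡ w

record Merging {N k} (M : Matching N k) (m : ℕ) : Set where
  field
    merged            : Fin N → Fin m
    merged-surjective : ∀ j → ∃ λ v → merged v ≡ j
    merged-glues      : ∀ {v w} → merged v ≡ merged w →
                        v ≡ w ⊎ Matched M v w ⊎ Matched M w v
open Merging

module Collapse {n} (y x : Fin (suc n)) (y≢x : y ≢ x) where

  collapse : Fin (suc n) → Fin n
  collapse v with y ≟ v
  ... | yes _   = punchOut y≢x
  ... | no y≢v = punchOut y≢v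

  collapse-off : ∀ {v} (y≢v : y ≢ v) → collapse v ≡ punchOut y≢v
  collapse-off {v} y≢v with y ≟ v
  ... | yes y≡v = ⊥-elim (y≢v y≡v)
  ... | no _    = punchOut-cong y refl

  collapse-y : collapse y ≡ collapse x
  collapse-y with y ≟ y
  ... | yes _   = sym≡ (collapse-off y≢x)
  ... | no y≢y = ⊥-elim (y≢y refl)

  collapse-injective-off : ∀ {v w} → y ≢ v → y ≢ w → collapse v ≡ collapse w → v ≡ w
  collapse-injective-off y≢v y≢w eq = punchOut-injective y≢v y≢w (begin
    punchOut y≢v ≡⟨ sym≡ (collapse-off y≢v) ⟩
    collapse _   ≡⟨ eq ⟩
    collapse _   ≡⟨ collapse-off y≢w ⟩
    punchOut y≢w ∎)
    where open ≡-Reasoning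

  -- Case split on v being y, opaque to the definition of collapse (so that
  -- splitting on it does not disturb hypotheses mentioning collapse v).
  is-y : ∀ v → y ≡ v ⊎ y ≢ v
  is-y v with y ≟ v
  ... | yes y≡v = inj₁ y≡v
  ... | no y≢v  = inj₂ y≢v

  collapse-fibre : ∀ {u v} → y ≢ u → x ≢ u → collapse v ≡ collapse u → v ≡ u
  collapse-fibre {v = v} y≢u x≢u eq with is-y v
  ... | inj₁ y≡v = ⊥-elim (x≢u (collapse-injective-off y≢x y≢u (begin
    collapse x ≡⟨ sym≡ collapse-y ⟩
    collapse y ≡⟨ cong collapse y≡v ⟩
    collapse v ≡⟨ eq ⟩
    collapse _ ∎)))
    where open ≡-Reasoning
  ... | inj₂ y≢v = collapse-injective-off y≢v y≢u eq

  collapse-glues : ∀ {v w} → collapse v ≡ collapse w →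
                   v ≡ w ⊎ (v ≡ x × w ≡ y) ⊎ (v ≡ y × w ≡ x)
  collapse-glues {v} {w} eq with is-y v | is-y w
  ... | inj₁ y≡v | inj₁ y≡w = inj₁ (trans (sym≡ y≡v) y≡w)
  ... | inj₁ y≡v | inj₂ y≢w = inj₂ (inj₂ (sym≡ y≡v , collapse-injective-off y≢w y≢x eq′))
    where
    eq′ : collapse w ≡ collapse x
    eq′ = trans (sym≡ eq) (trans (cong collapse (sym≡ y≡v)) collapse-y)
  ... | inj₂ y≢v | inj₁ y≡w = inj₂ (inj₁ (collapse-injective-off y≢v y≢x eq′ , sym≡ y≡w))
    where
    eq′ : collapse v ≡ collapse x
    eq′ = trans eq (trans (cong collapse (sym≡ y≡w)) collapse-y)
  ... | inj₂ y≢v | inj₂ y≢w = inj₁ (collapse-injective-off y≢v y≢w eq)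

  collapse-section : ∀ j → collapse (punchIn y j) ≡ j
  collapse-section j = trans (collapse-off (punchInᵢ≢i y j ∘ sym≡)) (punchOut-punchIn y)

module CollapseFirstPair {n k} (M : Matching (suc n) (suc k)) where

  y≢left : ∀ i → right M zero ≢ left M i
  y≢left i eq = left≢right M i zero (sym≡ eq)

  y≢right : ∀ i → right M zero ≢ right M (suc i)
  y≢right i = 0≢1+n ∘ right-injective M

  x≢left : ∀ i → left M zero ≢ left M (suc i)
  x≢left i = 0≢1+n ∘ left-injective M

  open Collapse (right M zero) (left M zero) (y≢left zero) public

  rest : Matching n k
  rest = record
    { left            = collapse ∘ left M ∘ suc
    ; right           = collapse ∘ right M ∘ suc
    ; left-injective  = λ {i} {j} → suc-injective ∘ left-injective M
        ∘ collapse-injective-off (y≢left (suc i)) (y≢left (suc j))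
    ; right-injective = λ {i} {j} → suc-injective ∘ right-injective M
        ∘ collapse-injective-off (y≢right i) (y≢right j)
    ; left≢right      = λ i j → left≢right M (suc i) (suc j)
        ∘ collapse-injective-off (y≢left (suc i)) (y≢right j)
    }

  lift : ∀ {v w} → Matched rest (collapse v) (collapse w) → Matched M v w
  lift (i , l , r) =
    suc i ,
    sym≡ (collapse-fibre (y≢left (suc i)) (x≢left i) (sym≡ l)) ,
    sym≡ (collapse-fibre (y≢right i) (left≢right M zero (suc i)) (sym≡ r))

merge : ∀ k {m} (M : Matching (k + m) k) → Merging M m
merge zero M = record
  { merged = λ v → v ; merged-surjective = λ j → j , refl ; merged-glues = inj₁ }
merge (suc k) {m} M = record
  { merged            = merged smaller ∘ collapse
  ; merged-surjective = surjective
  ; merged-glues      = glues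
  }
  where
  open CollapseFirstPair M
  smaller : Merging rest m
  smaller = merge k rest

  surjective : ∀ j → ∃ λ v → merged smaller (collapse v) ≡ j
  surjective j with merged-surjective smaller j
  ... | v , hit = punchIn (right M zero) v , trans (cong (merged smaller) (collapse-section v)) hit

  glues : ∀ {v w} → merged smaller (collapse v) ≡ merged smaller (collapse w) →
          v ≡ w ⊎ Matched M v w ⊎ Matched M w v
  glues eq with merged-glues smaller eq
  ... | inj₂ (inj₁ pair) = inj₂ (inj₁ (lift pair))
  ... | inj₂ (inj₂ pair) = inj₂ (inj₂ (lift pair))
  ... | inj₁ same with collapse-glues same
  ...   | inj₁ v≡w             = inj₁ v≡w
  ...   | inj₂ (inj₁ (vx , wy)) = inj₂ (inj₁ (zero , sym≡ vx , sym≡ wy))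
  ...   | inj₂ (inj₂ (vy , wx)) = inj₂ (inj₂ (zero , sym≡ wx , sym≡ vy))

merged-neighbourhood-partition :
  ∀ {m} (G : Graph (3 + m)) (c : Fin (3 + m)) →
  3 ≤ degree G c → degree G c ≤ (3 + m) ∸ 4 → PartitionDimLe G m
merged-neighbourhood-partition {m} G c 3≤deg deg≤ =
  m , ≤-refl , partition , LocatingCriterion.locating G partition c separated
  where
  open Neighbourhood G c
  near : Distinct (Fin (3 + m)) 3 (λ v → T (adj G c v))
  near = three-neighbours 3≤deg
  far : Distinct (Fin (3 + m)) 3 (λ v → ¬ T (adj G c v) × v ≢ c)
  far = three-non-neighbours 3≤deg deg≤

  M : Matching (3 + m) 3
  M = record
    { left            = pick near
    ; right           = pick far
    ; left-injective  = pick-injective near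
    ; right-injective = pick-injective far
    ; left≢right      = λ i j eq → proj₁ (pick-property far j)
        (subst (λ v → T (adj G c v)) eq (pick-property near i))
    }

  merging : Merging M m
  merging = merge 3 M

  partition : Partition (3 + m) m
  partition = record { cls = merged merging ; nonempty = merged-surjective merging }

  matched-separated : ∀ {v w} → Matched M v w → Separated G c v w
  matched-separated (i , refl , refl) = pick-property near i , pick-property far i

  separated : ∀ {v w} → merged merging v ≡ merged merging w →
              v ≡ w ⊎ Separated G c v w ⊎ Separated G c w v
  separated eq = Sum.map₂ (Sum.map matched-separated matched-separated) (merged-glues merging eq)

mainTheorem16 : (n : ℕ) → 7 ≤ n → (G : Graph n) → Connected G →
                (∃ λ (u : Fin n) → 3 ≤ degree G u × degree G u ≤ n ∸ 4) →
                PartitionDimLe G (n ∸ 3)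
mainTheorem16 (suc (suc (suc m))) _ G _ (c , 3≤deg , deg≤) =
  merged-neighbourhood-partition G c 3≤deg deg≤
mainTheorem16 0 () _ _ _
mainTheorem16 1 (s≤s ()) _ _ _
mainTheorem16 2 (s≤s (s≤s ())) _ _ _
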